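{- For $s\ge1$ and $\delta,\tau\in(0,1)$ there exists $q=q(s,\delta,\tau)$ (for fixed $s$, bounded by a polynomial in $1/\delta$ and $1/\tau$) such that for every $s$-rooted tree $T$ of $G'$, with probability at least $1-\tau$, for all $i\in[t(s)]$, $|\mathsf{Freq}(T)[i]-\widetilde{\mathsf{Freq}}_q(\mathrm{root}(T))[i]|\le\delta\deg_G(\mathrm{root}(T))$.
   Context: $G$ is a forest accessed in the adjacency list model and $G'$ is obtained from it by the partitioning construction with threshold $s$: high-degree vertices $V_h$ are those with $\deg_G(v)>s$, low-degree $V_l$ the rest; a component of $G[V_l]$ is large if it has more than $s$ vertices, small otherwise; $G'$ is obtained by removing all edges inside $V_h$, all edges between $V_h$ and any small component of $G[V_l]$ adjacent to at least two vertices of $V_h$, and all edges between $V_h$ and large components of $G[V_l]$. An alive-edge query $(v,k)$ reports whether the $k$-th edge incident to $v$ in $G$ is in $G'$. An $s$-rooted tree is a tree $T$ with a unique vertex $\mathrm{root}(T)$ of degree at least $s+1$ such that each component of $T-\mathrm{root}(T)$ (a subtree of the root, rooted at the neighbor of the root it contains) has at most $s$ vertices. Let $T^{(1)},\dots,T^{(t(s))}$ list all rooted trees with at most $s$ vertices up to rooted isomorphism. $\mathsf{Freq}(T)$ is the vector in $\mathbb{N}^{t(s)}$ whose $i$-th entry is the number of subtrees of $\mathrm{root}(T)$ isomorphic to $T^{(i)}$. Procedure $\widetilde{\mathsf{Freq}}_q(v)$: start with $\widetilde{F}=0\in\mathbb{R}^{t(s)}$; repeat $q$ times independently: choose $k\in[\deg_G(v)]$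 uniformly at random, ask whether the $k$-th edge $(v,u)$ incident to $v$ is alive; if so, explore by BFS the whole subtree rooted at $u$ and, if it is isomorphic to $T^{(i)}$, increase $\widetilde F[i]$ by $1$. Output $(\deg_G(v)/q)\widetilde F$.
   Formalization: The parameters δ and τ range only over the rationals in $(0,1)$. -}

module Defs where

open import Data.Nat using (ℕ; zero; suc; _≤_; _<_)
import Data.Nat
open import Data.Fin using (Fin; zero; suc; inject₁; fromℕ)
open import Data.List using (List; length; lookup)
open import Data.List.Membership.Propositional using (_∈_)
open import Data.List.Relation.Unary.Unique.Propositional using (Unique)
open import Data.Vec using (Vec)
import Data.Vec as Vec
open import Data.Bool using (Bool; true)
open import Data.Product using (Σ; ∃; _×_; _,_)
open import Data.Sum using (_⊎_)
open import Data.Empty using (⊥)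
open import Relation.Nullary using (¬_)
open import Relation.Binary.PropositionalEquality using (_≡_; _≢_)
open import Function.Definitions using (Injective)
open import Function.Bundles using (_⇔_)
open import Data.Integer using (+_)
open import Data.Rational using (ℚ; _*_; _-_; ∣_∣) renaming (_/_ to _/ℚ_; _≤_ to _≤ℚ_)
import Data.Rational as Q

ℕ→ℚ : ℕ → ℚ
ℕ→ℚ m = (+ m) /ℚ 1

_^ℚ_ : ℚ → ℕ → ℚ
p ^ℚ zero = Q.1ℚ
p ^ℚ suc k = p * (p ^ℚ k)

MoreThan : ∀ {n} → ℕ → (Fin n → Set) → Set
MoreThan {n} s P = Σ (Fin (suc s) → Fin n) λ f → Injective _≡_ _≡_ f × (∀ i → P (f i))

CountIs : {A : Set} → (A → Set) → ℕ → Set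
CountIs {A} P m = Σ (List A) λ L → Unique L × (∀ x → (x ∈ L) ⇔ P x) × length L ≡ m

EdgeRel : ℕ → Set₁
EdgeRel n = Fin n → Fin n → Set

data Reach {n} (E : EdgeRel n) : Fin n → Fin n → Set where
  here  : ∀ {x} → Reach E x x
  there : ∀ {x y z} → E x y → Reach E y z → Reach E x z

HasCycle : ∀ {n} → EdgeRel n → Set
HasCycle {n} E = Σ ℕ λ k → Σ (Fin (suc (suc (suc k))) → Fin n) λ v →
  Injective _≡_ _≡_ v ×
  (∀ (i : Fin (suc (suc k))) → E (v (inject₁ i)) (v (suc i))) ×
  E (v (fromℕ (suc (suc k)))) (v zero)

Acyclic : ∀ {n} → EdgeRel n → Set
Acyclic E = ¬ HasCycle E

Symmetric : ∀ {n} → EdgeRel n → Set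
Symmetric E = ∀ x y → E x y → E y x

Irreflexive : ∀ {n} → EdgeRel n → Set
Irreflexive E = ∀ x → ¬ E x x

-- Graphs in the adjacency list model: vertices Fin n, adj v = ordered
-- list of neighbours of v (the k-th edge incident to v is (v , lookup (adj v) k)).

record AdjGraph : Set where
  field
    n   : ℕ
    adj : Fin n → List (Fin n)

module _ (G : AdjGraph) where
  open AdjGraph G

  V : Set
  V = Fin n

  deg : V → ℕ
  deg v = length (adj v)

  nbr : (v : V) → Fin (deg v) → V
  nbr v k = lookup (adj v) k

  Edge : EdgeRel n
  Edge u v = v ∈ adj u

  IsSimpleGraph : Set
  IsSimpleGraph = Symmetric Edge × Irreflexive Edge × (∀ v → Unique (adj v))

  IsForest : Set
  IsForest = IsSimpleGraph × Acyclic Edge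

  module Partition (s : ℕ) where

    High : V → Set
    High v = s < deg v

    Low : V → Set
    Low v = deg v ≤ s

    ELow : EdgeRel n
    ELow x y = Low x × Low y × Edge x y

    InLowComp : V → V → Set
    InLowComp l x = Reach ELow l x

    LargeComp : V → Set
    LargeComp l = MoreThan s (InLowComp l)

    AdjTwoHigh : V → Set
    AdjTwoHigh l = Σ V λ h₁ → Σ V λ h₂ → Σ V λ c₁ → Σ V λ c₂ →
      h₁ ≢ h₂ × High h₁ × High h₂ × InLowComp l c₁ × InLowComp l c₂ ×
      Edge c₁ h₁ × Edge c₂ h₂

    RemovedHL : V → V → Set
    RemovedHL h l = High h × Low l × (LargeComp l ⊎ (¬ LargeComp l × AdjTwoHigh l))

    Removed : V → V → Set
    Removed u v = (High u × High v) ⊎ RemovedHL u v ⊎ RemovedHL v u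

    E' : EdgeRel n
    E' u v = Edge u v × ¬ Removed u v

    Alive : (v : V) → Fin (deg v) → Set
    Alive v k = E' v (nbr v k)

    EMinus : V → EdgeRel n
    EMinus r x y = E' x y × x ≢ r × y ≢ r

    -- x is in the subtree of r rooted at the neighbour u (component of u in G' − r)
    InSubtree : V → V → V → Set
    InSubtree r u x = Reach (EMinus r) u x

    -- the connected component of G' containing r is an s-rooted tree with root r
    -- (it is a tree since G is a forest and G' ⊆ G)
    IsSRootedRoot : V → Set
    IsSRootedRoot r =
      MoreThan s (E' r) ×
      (∀ w → Reach E' r w → w ≢ r → ¬ MoreThan s (E' w)) ×
      (∀ u → E' r u → ¬ MoreThan s (InSubtree r u))

record RootedTree : Set where
  field
    m    : ℕ
    ER   : Fin m → Fin m → Bool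
    root : Fin m

  ERel : EdgeRel m
  ERel a b = ER a b ≡ true

  IsTree : Set
  IsTree = Symmetric ERel × Irreflexive ERel × (∀ a b → Reach ERel a b) × Acyclic ERel

module _ (G : AdjGraph) (s : ℕ) where
  open Partition G s

  SubtreeIso : V G → V G → RootedTree → Set
  SubtreeIso r u R =
    Σ (Fin m → V G) λ f →
      Injective _≡_ _≡_ f ×
      (∀ x → InSubtree r u x → Σ (Fin m) λ a → f a ≡ x) ×
      (∀ a → InSubtree r u (f a)) ×
      f root ≡ u ×
      (∀ a b → (ERel a b) ⇔ E' (f a) (f b))
    where open RootedTree R

  GoodEdge : (r : V G) → RootedTree → Fin (deg G r) → Set
  GoodEdge r R k = Alive r k × SubtreeIso r (nbr G r k) R

  -- Freq(T)[R] = m1 : number of subtrees of the root r isomorphic to R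
  -- (subtrees of r correspond bijectively to the alive edges at r, G being simple)
  FreqIs : (r : V G) → RootedTree → ℕ → Set
  FreqIs r R m1 = CountIs (GoodEdge r R) m1

  -- for an outcome ω of the q random choices k_1..k_q, the number of j with
  -- the edge k_j alive and its subtree isomorphic to R is m2
  -- (so that Freq~_q(r)[R] = (deg r / q) * m2)
  SampleCountIs : (r : V G) (q : ℕ) → Vec (Fin (deg G r)) q → RootedTree → ℕ → Set
  SampleCountIs r q ω R m2 = CountIs (λ (j : Fin q) → GoodEdge r R (Vec.lookup ω j)) m2

  GoodOutcome : (r : V G) (q : ℕ) → .{{_ : Data.Nat.NonZero q}} → ℚ → Vec (Fin (deg G r)) q → Set
  GoodOutcome r q δ ω = ∀ (R : RootedTree) → RootedTree.IsTree R →
    1 ≤ RootedTree.m R → RootedTree.m R ≤ s →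
    ∀ m1 m2 → FreqIs r R m1 → SampleCountIs r q ω R m2 →
    ∣ ℕ→ℚ m1 - (+ (deg G r Data.Nat.* m2)) /ℚ q ∣ ≤ℚ δ * ℕ→ℚ (deg G r)

-- Uniform probability on outcomes ω ∈ [d]^q (q independent uniform choices
-- from Fin d): Pr[P] ≥ p  iff  at least p · d^q outcomes satisfy P.
ProbAtLeast : (d q : ℕ) → (Vec (Fin d) q → Set) → ℚ → Set
ProbAtLeast d q P p = Σ (List (Vec (Fin d) q)) λ L →
  Unique L × (∀ ω → ω ∈ L → P ω) × (p * ℕ→ℚ (d Data.Nat.^ q) ≤ℚ ℕ→ℚ (length L))

-- Let d = deg r.  For a candidate shape R, let m be the number of edges at r whose subtree is
-- isomorphic to R (so m = Freq(T)[R]) and, for an outcome ω ∈ [d]^q of the q samples, let h(ω) be the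
-- number of sampled edges of that kind; the estimate is (d/q)·h(ω).  Counting over the d^q equally
-- likely outcomes, the second moment is exact: Σ_ω (d·h(ω) − q·m)² = q·m·(d − m)·d^q, by induction on
-- q.  By Chebyshev, |m − (d/q)·h(ω)| > δd on at most a 1/(δ²q) fraction of the outcomes.  A union bound
-- over the N candidate shapes on at most s vertices and q ≈ N/(δ²τ) leave a fraction 1 − τ of outcomes
-- that are good for every shape at once, and this q satisfies (q + 1)·(δτ)³ ≤ N + 1.

module Submission where

open import Algebra.Bundles using (CommutativeSemiring)
open import Data.Nat.Base using (ℕ)
open import Relation.Nullary using (Dec)
open import Defs

module ListSum {c ℓ} (R : CommutativeSemiring c ℓ) where
  open import Data.List using (List; []; _∷_; _++_; map; cartesianProductWith)
  open import Function using (_∘_)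
  import Relation.Binary.PropositionalEquality as ≡
  open CommutativeSemiring R
  open import Relation.Binary.Reasoning.Setoid setoid
  open import Algebra.Properties.CommutativeSemigroup +-commutativeSemigroup using (interchange)

  private variable
    A B C : Set

  ∑ : List A → (A → Carrier) → Carrier
  ∑ []       f = 0#
  ∑ (x ∷ xs) f = f x + ∑ xs f

  ∑-cong : ∀ (xs : List A) {f g} → (∀ x → f x ≈ g x) → ∑ xs f ≈ ∑ xs g
  ∑-cong []       f≈g = refl
  ∑-cong (x ∷ xs) f≈g = +-cong (f≈g x) (∑-cong xs f≈g)

  ∑-+ : ∀ (xs : List A) f g → ∑ xs (λ x → f x + g x) ≈ ∑ xs f + ∑ xs g
  ∑-+ []       f g = sym (+-identityˡ 0#)
  ∑-+ (x ∷ xs) f g = begin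
    f x + g x + ∑ xs (λ x → f x + g x) ≈⟨ +-congˡ (∑-+ xs f g) ⟩
    f x + g x + (∑ xs f + ∑ xs g)      ≈⟨ interchange (f x) (g x) (∑ xs f) (∑ xs g) ⟩
    f x + ∑ xs f + (g x + ∑ xs g)      ∎

  ∑-*ˡ : ∀ (xs : List A) k f → ∑ xs (λ x → k * f x) ≈ k * ∑ xs f
  ∑-*ˡ []       k f = sym (zeroʳ k)
  ∑-*ˡ (x ∷ xs) k f = trans (+-congˡ (∑-*ˡ xs k f)) (sym (distribˡ k (f x) (∑ xs f)))

  ∑-*ʳ : ∀ (xs : List A) k f → ∑ xs (λ x → f x * k) ≈ ∑ xs f * k
  ∑-*ʳ xs k f = trans (∑-cong xs (λ x → *-comm (f x) k)) (trans (∑-*ˡ xs k f) (*-comm k (∑ xs f)))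

  ∑-comm : ∀ (xs : List A) (ys : List B) (f : A → B → Carrier) →
           ∑ xs (λ x → ∑ ys (f x)) ≈ ∑ ys (λ y → ∑ xs (λ x → f x y))
  ∑-comm []       ys f = sym (∑-zero ys)
    where
    ∑-zero : ∀ (ys : List B) → ∑ ys (λ _ → 0#) ≈ 0#
    ∑-zero []       = refl
    ∑-zero (y ∷ ys) = trans (+-congˡ (∑-zero ys)) (+-identityˡ 0#)
  ∑-comm (x ∷ xs) ys f = trans (+-congˡ (∑-comm xs ys f)) (sym (∑-+ ys (f x) (λ y → ∑ xs (λ x → f x y))))

  ∑-++ : ∀ (xs ys : List A) f → ∑ (xs ++ ys) f ≈ ∑ xs f + ∑ ys f
  ∑-++ []       ys f = sym (+-identityˡ (∑ ys f))
  ∑-++ (x ∷ xs) ys f = trans (+-congˡ (∑-++ xs ys f)) (sym (+-assoc (f x) (∑ xs f) (∑ ys f)))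

  ∑-map : ∀ (g : A → B) xs f → ∑ (map g xs) f ≡.≡ ∑ xs (f ∘ g)
  ∑-map g []       f = ≡.refl
  ∑-map g (x ∷ xs) f = ≡.cong (f (g x) +_) (∑-map g xs f)

  ∑-cartesianProductWith : ∀ (g : A → B → C) xs ys f →
    ∑ (cartesianProductWith g xs ys) f ≈ ∑ xs (λ x → ∑ ys (λ y → f (g x y)))
  ∑-cartesianProductWith g []       ys f = refl
  ∑-cartesianProductWith g (x ∷ xs) ys f = begin
    ∑ (map (g x) ys ++ cartesianProductWith g xs ys) f       ≈⟨ ∑-++ (map (g x) ys) _ f ⟩
    ∑ (map (g x) ys) f + ∑ (cartesianProductWith g xs ys) f  ≈⟨ +-cong (reflexive (∑-map (g x) ys f))
                                                                        (∑-cartesianProductWith g xs ys f) ⟩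
    ∑ ys (f ∘ g x) + ∑ xs (λ x → ∑ ys (λ y → f (g x y)))     ∎

module Counting where
  open import Data.Nat using (ℕ; zero; suc; _+_; _≤_; _<_)
  open import Data.Nat.Properties using (≤-antisym; ≤-trans; ≤-reflexive)
  open import Data.Fin using (Fin; zero; suc; inject≤)
  open import Data.Fin.Properties using (injective⇒≤; inject≤-injective)
  open import Data.List using (List; _∷_; length; lookup; filter; tabulate; allFin)
  open import Data.List.Properties using (length-filter; length-tabulate)
  open import Data.List.Membership.Propositional using (_∈_)
  open import Data.List.Membership.Propositional.Properties using (∈-lookup; ∈-filter⁺; ∈-filter⁻; ∈-allFin)
  open import Data.List.Relation.Binary.Subset.Propositional using (_⊆_)
  open import Data.List.Relation.Unary.Any as Any using (here; there)
  open import Data.List.Relation.Unary.Any.Properties using (lookup-index)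
  import Data.List.Relation.Unary.All as All
  open import Data.List.Relation.Unary.AllPairs using (_∷_)
  open import Data.List.Relation.Unary.Unique.Propositional using (Unique)
  open import Data.List.Relation.Unary.Unique.Propositional.Properties using (filter⁺; allFin⁺)
  open import Data.Product using (_,_; proj₂)
  open import Data.Empty using (⊥-elim)
  open import Relation.Nullary using (¬_; Dec; yes; no)
  open import Relation.Unary using (Decidable)
  open import Relation.Binary.PropositionalEquality
  open import Function using (_∘_)
  open import Function.Definitions using (Injective)
  open import Function.Bundles using (_⇔_; mk⇔; Equivalence)

  private variable
    A : Set
    n k s m m′ : ℕ
    xs ys : List A
    P Q : A → Set

  lookup-injective : Unique xs → Injective _≡_ _≡_ (lookup xs)
  lookup-injective {xs = x ∷ xs} (x∉xs ∷ u) {zero}  {zero}  eq = refl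
  lookup-injective {xs = x ∷ xs} (x∉xs ∷ u) {zero}  {suc j} eq = ⊥-elim (All.lookup x∉xs (∈-lookup j) eq)
  lookup-injective {xs = x ∷ xs} (x∉xs ∷ u) {suc i} {zero}  eq = ⊥-elim (All.lookup x∉xs (∈-lookup i) (sym eq))
  lookup-injective {xs = x ∷ xs} (x∉xs ∷ u) {suc i} {suc j} eq = cong suc (lookup-injective u eq)

  injection-length : (f : Fin k → A) → Injective _≡_ _≡_ f → (∀ i → f i ∈ ys) → k ≤ length ys
  injection-length {ys = ys} f f-inj f∈ys = injective⇒≤ (λ eq → f-inj (position-injective eq))
    where
    position-injective : ∀ {i j} → Any.index (f∈ys i) ≡ Any.index (f∈ys j) → f i ≡ f j
    position-injective {i} {j} eq =
      trans (lookup-index (f∈ys i)) (trans (cong (lookup ys) eq) (sym (lookup-index (f∈ys j))))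

  unique-⊆-length : Unique xs → xs ⊆ ys → length xs ≤ length ys
  unique-⊆-length {xs = xs} u xs⊆ys = injection-length (lookup xs) (lookup-injective u) (xs⊆ys ∘ ∈-lookup)

  CountIs-mono : CountIs P m → CountIs Q m′ → (∀ x → P x → Q x) → m ≤ m′
  CountIs-mono (L , u , L⇔P , refl) (L′ , _ , L′⇔Q , refl) P⊆Q =
    unique-⊆-length u (λ {x} → Equivalence.from (L′⇔Q x) ∘ P⊆Q x ∘ Equivalence.to (L⇔P x))

  CountIs-unique : CountIs P m → CountIs P m′ → m ≡ m′
  CountIs-unique c c′ = ≤-antisym (CountIs-mono c c′ (λ _ p → p)) (CountIs-mono c′ c (λ _ p → p))

  CountIs-strict : CountIs P m → CountIs Q m′ → (∀ x → P x → Q x) → ∀ y → Q y → ¬ P y → m < m′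
  CountIs-strict {P = P} (L , u , L⇔P , refl) (L′ , _ , L′⇔Q , refl) P⊆Q y Qy ¬Py =
    unique-⊆-length (All.tabulate y∉L ∷ u) y∷L⊆L′
    where
    y∉L : ∀ {x} → x ∈ L → y ≢ x
    y∉L x∈L refl = ¬Py (Equivalence.to (L⇔P y) x∈L)
    y∷L⊆L′ : y ∷ L ⊆ L′
    y∷L⊆L′ (here refl)  = Equivalence.from (L′⇔Q y) Qy
    y∷L⊆L′ (there x∈L) = Equivalence.from (L′⇔Q _) (P⊆Q _ (Equivalence.to (L⇔P _) x∈L))

  CountIs-resp-⇔ : (∀ x → P x ⇔ Q x) → CountIs P m → CountIs Q m
  CountIs-resp-⇔ P⇔Q (L , u , L⇔P , eq) =
    L , u , (λ x → mk⇔ (Equivalence.to (P⇔Q x) ∘ Equivalence.to (L⇔P x))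
                       (Equivalence.from (L⇔P x) ∘ Equivalence.from (P⇔Q x))) , eq

  CountIs⇒MoreThan⇔< : {P : Fin n → Set} → CountIs P m → MoreThan s P ⇔ s < m
  CountIs⇒MoreThan⇔< {s = s} (L , u , L⇔P , refl) = mk⇔
    (λ (f , f-inj , Pf) → injection-length f f-inj (λ i → Equivalence.from (L⇔P (f i)) (Pf i)))
    (λ s<m → (λ i → lookup L (inject≤ i s<m)) ,
             (λ {i} {j} eq → inject≤-injective s<m s<m i j (lookup-injective u eq)) ,
             (λ i → Equivalence.to (L⇔P _) (∈-lookup (inject≤ i s<m))))

  indicator : Dec A → ℕ
  indicator (yes _) = 1
  indicator (no _)  = 0

  length-filter-∷ : (P? : Decidable P) (x : A) (xs : List A) →
                    length (filter P? (x ∷ xs)) ≡ indicator (P? x) + length (filter P? xs)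
  length-filter-∷ P? x xs with P? x
  ... | yes _ = refl
  ... | no _  = refl

  count : {P : Fin n → Set} → Decidable P → ℕ
  count P? = length (filter P? (allFin _))

  count-CountIs : {P : Fin n → Set} (P? : Decidable P) → CountIs P (count P?)
  count-CountIs P? = filter P? (allFin _) , filter⁺ P? (allFin⁺ _) ,
    (λ i → mk⇔ (proj₂ ∘ ∈-filter⁻ P? {xs = allFin _}) (∈-filter⁺ P? (∈-allFin i))) , refl

  count≤ : {P : Fin n → Set} (P? : Decidable P) → count P? ≤ n
  count≤ P? = ≤-trans (length-filter P? (allFin _)) (≤-reflexive (length-tabulate (λ i → i)))

  count-tabulate : {P : A → Set} (P? : Decidable P) (f : Fin n → A) →
                   length (filter P? (tabulate f)) ≡ count (P? ∘ f)
  count-tabulate {n = zero}  P? f = refl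
  count-tabulate {n = suc n} P? f with P? (f zero)
  ... | yes _ = cong suc (trans (count-tabulate P? (f ∘ suc)) (sym (count-tabulate (P? ∘ f) suc)))
  ... | no _  = trans (count-tabulate P? (f ∘ suc)) (sym (count-tabulate (P? ∘ f) suc))

  count-suc : {P : Fin (suc n) → Set} (P? : Decidable P) → count P? ≡ indicator (P? zero) + count (P? ∘ suc)
  count-suc P? = trans (length-filter-∷ P? zero (tabulate suc)) (cong (indicator (P? zero) +_) (count-tabulate P? suc))

module FiniteReachability {n : ℕ} (E : EdgeRel n) (E? : ∀ x y → Dec (E x y)) where
  open import Data.Nat using (ℕ; zero; suc; _≤_; _<_; s≤s; _≤′_; ≤′-refl; ≤′-step)
  open import Data.Nat.Properties using (≤-refl; <-≤-trans; <⇒≤; <-irrefl; m≤n⇒m≤1+n; anyUpTo?; ≤⇒≤′)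
  open import Data.Fin using (Fin)
  open import Data.Fin.Properties using (_≟_; any?; all?)
  open import Data.Product using (∃; _×_; _,_)
  open import Data.Sum using (_⊎_; inj₁; inj₂)
  open import Data.Empty using (⊥-elim)
  open import Relation.Nullary using (¬_; Dec; yes; no)
  open import Relation.Nullary.Decidable using (_×-dec_; _⊎-dec_; _→-dec_; ¬?; map′; decidable-stable)
  open import Relation.Binary.PropositionalEquality using (_≡_; refl)
  open import Data.List.Properties using (filter-some)
  open import Data.List.Membership.Propositional.Properties using (∈-allFin)
  open import Function using (_∘′_)
  open Counting

  private variable
    j k : ℕ
    x y z : Fin n

  ReachWithin : ℕ → Fin n → Fin n → Set
  ReachWithin zero    x y = x ≡ y
  ReachWithin (suc k) x y = ReachWithin k x y ⊎ ∃ λ z → ReachWithin k x z × E z y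

  reachWithin? : ∀ k x y → Dec (ReachWithin k x y)
  reachWithin? zero    x y = x ≟ y
  reachWithin? (suc k) x y = reachWithin? k x y ⊎-dec any? (λ z → reachWithin? k x z ×-dec E? z y)

  ReachWithin-refl : ∀ k x → ReachWithin k x x
  ReachWithin-refl zero    x = refl
  ReachWithin-refl (suc k) x = inj₁ (ReachWithin-refl k x)

  ReachWithin-mono : j ≤ k → ReachWithin j x y → ReachWithin k x y
  ReachWithin-mono j≤k w = go (≤⇒≤′ j≤k) w
    where
    go : ∀ {k} → j ≤′ k → ReachWithin j x y → ReachWithin k x y
    go ≤′-refl        w = w
    go (≤′-step j≤′k) w = inj₁ (go j≤′k w)

  Reach-snoc : Reach E x y → E y z → Reach E x z
  Reach-snoc here          e = there e here
  Reach-snoc (there e′ xy) e = there e′ (Reach-snoc xy e)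

  ReachWithin⇒Reach : ∀ k → ReachWithin k x y → Reach E x y
  ReachWithin⇒Reach zero    refl                = here
  ReachWithin⇒Reach (suc k) (inj₁ w)           = ReachWithin⇒Reach k w
  ReachWithin⇒Reach (suc k) (inj₂ (z , w , e)) = Reach-snoc (ReachWithin⇒Reach k w) e

  Closed : ℕ → Fin n → Set
  Closed k x = ∀ y → ReachWithin (suc k) x y → ReachWithin k x y

  closed? : ∀ x k → Dec (Closed k x)
  closed? x k = all? (λ y → reachWithin? (suc k) x y →-dec reachWithin? k x y)

  ReachWithin-closed : Closed k x → ReachWithin k x z → Reach E z y → ReachWithin k x y
  ReachWithin-closed closed w here         = w
  ReachWithin-closed closed w (there e zy) = ReachWithin-closed closed (closed _ (inj₂ (_ , w , e))) zy

  ¬Closed⇒grows : ¬ Closed k x → count (reachWithin? k x) < count (reachWithin? (suc k) x)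
  ¬Closed⇒grows {k} {x} ¬closed with any? (λ y → reachWithin? (suc k) x y ×-dec ¬? (reachWithin? k x y))
  ... | yes (y , new , ¬old) = CountIs-strict (count-CountIs _) (count-CountIs _) (λ _ → inj₁) y new ¬old
  ... | no none = ⊥-elim (¬closed λ y w → decidable-stable (reachWithin? k x y) (λ ¬old → none (y , w , ¬old)))

  ¬Closed⇒count> : ∀ k → (∀ {j} → j < k → ¬ Closed j x) → k < count (reachWithin? k x)
  ¬Closed⇒count> {x} zero    _      = filter-some (reachWithin? zero x) (∈-allFin x)
  ¬Closed⇒count> {x} (suc k) ¬closed =
    <-≤-trans (s≤s (¬Closed⇒count> k (¬closed ∘′ m≤n⇒m≤1+n))) (¬Closed⇒grows (¬closed ≤-refl))

  -- Some radius below n is closed, for otherwise the balls around x would outgrow the n vertices.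
  Reach⇒ReachWithin : Reach E x y → ReachWithin n x y
  Reach⇒ReachWithin {x} xy with anyUpTo? (closed? x) n
  ... | yes (k , k<n , closed) = ReachWithin-mono (<⇒≤ k<n) (ReachWithin-closed closed (ReachWithin-refl k x) xy)
  ... | no none = ⊥-elim (<-irrefl refl (<-≤-trans (¬Closed⇒count> n (λ j<n closed → none (_ , j<n , closed)))
                                                   (count≤ (reachWithin? n x))))

  Reach? : ∀ x y → Dec (Reach E x y)
  Reach? x y = map′ (ReachWithin⇒Reach n) Reach⇒ReachWithin (reachWithin? n x y)

module Decidability (G : AdjGraph) (s : ℕ) where
  open import Data.Nat using (ℕ; zero; suc)
  open import Data.Nat.Properties using (_<?_; _≤?_)
  open import Data.Fin using (Fin)
  open import Data.Fin.Properties using (_≟_; any?; all?)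
  open import Data.Bool using (true)
  import Data.Bool.Properties as Bool
  open import Data.Vec using (Vec; []; _∷_; lookup; tabulate)
  open import Data.Vec.Properties using (lookup∘tabulate)
  open import Data.Product using (Σ; _×_; _,_)
  open import Relation.Nullary using (Dec)
  open import Relation.Nullary.Decidable using (_×-dec_; _⊎-dec_; _→-dec_; ¬?; map′)
  open import Relation.Binary.PropositionalEquality using (_≡_; sym; trans; subst; subst₂)
  open import Function.Definitions using (Injective)
  open import Function.Bundles using (_⇔_; mk⇔; Equivalence)
  open AdjGraph G
  open Partition G s
  open import Data.List.Membership.DecPropositional (_≟_ {n}) using (_∈?_)

  _⇔-dec_ : ∀ {A B : Set} → Dec A → Dec B → Dec (A ⇔ B)
  a? ⇔-dec b? = map′ (λ (f , g) → mk⇔ f g) (λ e → Equivalence.to e , Equivalence.from e) ((a? →-dec b?) ×-dec (b? →-dec a?))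

  any-Vec? : ∀ {m} k {P : Vec (Fin m) k → Set} → (∀ v → Dec (P v)) → Dec (Σ (Vec (Fin m) k) P)
  any-Vec? zero    P? = map′ ([] ,_) (λ { ([] , p) → p }) (P? [])
  any-Vec? (suc k) P? = map′ (λ (x , v , p) → x ∷ v , p) (λ { (x ∷ v , p) → x , v , p })
                             (any? λ x → any-Vec? k (λ v → P? (x ∷ v)))

  edge? : ∀ u v → Dec (Edge G u v)
  edge? u v = v ∈? adj u

  high? : ∀ v → Dec (High v)
  high? v = s <? deg G v

  low? : ∀ v → Dec (Low v)
  low? v = deg G v ≤? s

  inLowComp? : ∀ l x → Dec (InLowComp l x)
  inLowComp? = FiniteReachability.Reach? ELow (λ x y → low? x ×-dec low? y ×-dec edge? x y)

  largeComp? : ∀ l → Dec (LargeComp l)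
  largeComp? l = map′ from to (s <? Counting.count (inLowComp? l))
    where open Equivalence (Counting.CountIs⇒MoreThan⇔< (Counting.count-CountIs (inLowComp? l)))

  adjTwoHigh? : ∀ l → Dec (AdjTwoHigh l)
  adjTwoHigh? l = any? λ h₁ → any? λ h₂ → any? λ c₁ → any? λ c₂ →
    ¬? (h₁ ≟ h₂) ×-dec high? h₁ ×-dec high? h₂ ×-dec inLowComp? l c₁ ×-dec inLowComp? l c₂ ×-dec
    edge? c₁ h₁ ×-dec edge? c₂ h₂

  removedHL? : ∀ h l → Dec (RemovedHL h l)
  removedHL? h l = high? h ×-dec low? l ×-dec (largeComp? l ⊎-dec (¬? (largeComp? l) ×-dec adjTwoHigh? l))

  E′? : ∀ u v → Dec (E' u v)
  E′? u v = edge? u v ×-dec ¬? ((high? u ×-dec high? v) ⊎-dec removedHL? u v ⊎-dec removedHL? v u)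

  inSubtree? : ∀ r u x → Dec (InSubtree r u x)
  inSubtree? r = FiniteReachability.Reach? (EMinus r) (λ x y → E′? x y ×-dec ¬? (x ≟ r) ×-dec ¬? (y ≟ r))

  module _ (r u : V G) (R : RootedTree) where
    open RootedTree R

    IsSubtreeIso : (Fin m → V G) → Set
    IsSubtreeIso f = Injective _≡_ _≡_ f ×
      (∀ x → InSubtree r u x → Σ (Fin m) λ a → f a ≡ x) ×
      (∀ a → InSubtree r u (f a)) ×
      f root ≡ u ×
      (∀ a b → (ERel a b) ⇔ E' (f a) (f b))

    isSubtreeIso? : ∀ f → Dec (IsSubtreeIso f)
    isSubtreeIso? f = map′ (λ inj {a} {b} → inj a b) (λ inj a b → inj {a} {b})
                        (all? λ a → all? λ b → (f a ≟ f b) →-dec (a ≟ b))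
      ×-dec all? (λ x → inSubtree? r u x →-dec any? (λ a → f a ≟ x))
      ×-dec all? (λ a → inSubtree? r u (f a))
      ×-dec (f root ≟ u)
      ×-dec all? (λ a → all? λ b → (ER a b Bool.≟ true) ⇔-dec E′? (f a) (f b))

    IsSubtreeIso-resp-≗ : ∀ {f g} → (∀ a → f a ≡ g a) → IsSubtreeIso f → IsSubtreeIso g
    IsSubtreeIso-resp-≗ f≗g (inj , onto , into , f-root , f-edges) =
      (λ {a} {b} eq → inj (trans (f≗g a) (trans eq (sym (f≗g b))))) ,
      (λ x x∈ → let (a , fa≡x) = onto x x∈ in a , trans (sym (f≗g a)) fa≡x) ,
      (λ a → subst (InSubtree r u) (f≗g a) (into a)) ,
      trans (sym (f≗g root)) f-root ,
      (λ a b → subst₂ (λ y z → ERel a b ⇔ E' y z) (f≗g a) (f≗g b) (f-edges a b))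

    subtreeIso? : Dec (SubtreeIso G s r u R)
    subtreeIso? = map′ (λ (v , iso) → lookup v , iso)
                       (λ (f , iso) → tabulate f , IsSubtreeIso-resp-≗ (λ a → sym (lookup∘tabulate f a)) iso)
                       (any-Vec? m (isSubtreeIso? ∘ lookup))
      where open import Function using (_∘_)

  goodEdge? : ∀ r R k → Dec (GoodEdge G s r R k)
  goodEdge? r R k = E′? r (nbr G r k) ×-dec subtreeIso? r (nbr G r k) R

module RootedTreeShapes where
  open import Data.Nat using (ℕ; zero; suc; _*_; _^_; _≤_; s≤s)
  open import Data.Fin using (Fin)
  open import Data.Bool using (Bool; true; false)
  open import Data.List using (List; []; _∷_; length; map; concatMap; cartesianProductWith; allFin; upTo)
  open import Data.List.Properties using (length-++; length-map)
  open import Data.List.Membership.Propositional using (_∈_)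
  open import Data.List.Membership.Propositional.Properties
    using (∈-map⁺; ∈-concatMap⁺; ∈-cartesianProductWith⁺; ∈-allFin; ∈-upTo⁺)
  open import Data.List.Relation.Unary.Any as Any using (here; there)
  open import Data.List.Relation.Unary.Unique.Propositional using (Unique)
  open import Data.List.Relation.Unary.Unique.Propositional.Properties using (cartesianProductWith⁺)
  open import Data.Vec using (Vec; []; _∷_; lookup; tabulate)
  open import Data.Vec.Properties using (lookup∘tabulate)
  open import Data.Product using (Σ; _×_; _,_)
  open import Relation.Binary.PropositionalEquality using (_≡_; refl; cong; cong₂; trans; sym)
  open import Function.Bundles using (_⇔_; mk⇔; Equivalence)
  open import Function.Properties.Equivalence using () renaming (trans to ⇔-trans; sym to ⇔-sym)

  private variable
    A : Set

  vectors : List A → (k : ℕ) → List (Vec A k)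
  vectors xs zero    = [] ∷ []
  vectors xs (suc k) = cartesianProductWith _∷_ xs (vectors xs k)

  ∈-vectors : {xs : List A} → (∀ x → x ∈ xs) → ∀ {k} (v : Vec A k) → v ∈ vectors xs k
  ∈-vectors ∈xs []      = here refl
  ∈-vectors ∈xs (x ∷ v) = ∈-cartesianProductWith⁺ _∷_ (∈xs x) (∈-vectors ∈xs v)

  vectors-unique : {xs : List A} → Unique xs → ∀ k → Unique (vectors xs k)
  vectors-unique u zero    = [] ∷ []
    where open import Data.List.Relation.Unary.All using ([])
          open import Data.List.Relation.Unary.AllPairs using ([]; _∷_)
  vectors-unique u (suc k) = cartesianProductWith⁺ _∷_ ∷-injective u (vectors-unique u k)
    where
    ∷-injective : ∀ {k} {x y : A} {v w : Vec A k} → x ∷ v ≡ y ∷ w → x ≡ y × v ≡ w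
    ∷-injective refl = refl , refl

  length-vectors : (xs : List A) → ∀ k → length (vectors xs k) ≡ length xs ^ k
  length-vectors xs zero    = refl
  length-vectors xs (suc k) = trans (length-product xs (vectors xs k)) (cong (length xs *_) (length-vectors xs k))
    where
    length-product : ∀ (xs : List A) {k} (ys : List (Vec A k)) →
                     length (cartesianProductWith _∷_ xs ys) ≡ length xs * length ys
    length-product []       ys = refl
    length-product (x ∷ xs) ys =
      trans (length-++ (map (x ∷_) ys)) (cong₂ Data.Nat._+_ (length-map (x ∷_) ys) (length-product xs ys))

  booleans : List Bool
  booleans = true ∷ false ∷ []

  ∈-booleans : ∀ b → b ∈ booleans
  ∈-booleans true  = here refl
  ∈-booleans false = there (here refl)

  matrixTree : (m : ℕ) → Vec (Vec Bool m) m → Fin m → RootedTree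
  matrixTree m rows root = record { m = m ; ER = λ a b → lookup (lookup rows a) b ; root = root }

  treesWithMatrix : ∀ m → Vec (Vec Bool m) m → List RootedTree
  treesWithMatrix m rows = map (matrixTree m rows) (allFin m)

  treesOfSize : ℕ → List RootedTree
  treesOfSize m = concatMap (treesWithMatrix m) (vectors (vectors booleans m) m)

  -- Every Boolean adjacency matrix on at most s vertices with every choice of root: besides the T^(i) this
  -- lists non-trees and isomorphic copies, which only weakens the union bound taken over it.
  treesUpTo : ℕ → List RootedTree
  treesUpTo s = concatMap treesOfSize (upTo (suc s))

  module _ (G : AdjGraph) (s : ℕ) (r : V G) where
    open Partition G s

    SubtreeIso-resp-ER : ∀ {u} (R : RootedTree) (let open RootedTree R) {ER′ : Fin m → Fin m → Bool} →
      (∀ a b → ER′ a b ≡ ER a b) → SubtreeIso G s r u R ⇔ SubtreeIso G s r u (record R { ER = ER′ })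
    SubtreeIso-resp-ER R ER′≡ER = mk⇔
      (λ (f , inj , onto , into , f-root , f-edges) → f , inj , onto , into , f-root , λ a b → ⇔-trans (edge⇔ a b) (f-edges a b))
      (λ (f , inj , onto , into , f-root , f-edges) → f , inj , onto , into , f-root , λ a b → ⇔-trans (⇔-sym (edge⇔ a b)) (f-edges a b))
      where
      edge⇔ : ∀ a b → (_ ≡ true) ⇔ (_ ≡ true)
      edge⇔ a b = mk⇔ (trans (sym (ER′≡ER a b))) (trans (ER′≡ER a b))

    GoodEdge-representative : ∀ R → RootedTree.m R ≤ s →
      Σ RootedTree λ R′ → R′ ∈ treesUpTo s × (∀ k → GoodEdge G s r R k ⇔ GoodEdge G s r R′ k)
    GoodEdge-representative R m≤s = matrixTree m rows root , ∈-treesUpTo , λ k →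
      mk⇔ (λ (alive , iso) → alive , Equivalence.to (SubtreeIso-resp-ER R ER′≡ER) iso)
          (λ (alive , iso) → alive , Equivalence.from (SubtreeIso-resp-ER R ER′≡ER) iso)
      where
      open RootedTree R
      rows : Vec (Vec Bool m) m
      rows = tabulate (λ a → tabulate (ER a))
      ER′≡ER : ∀ a b → lookup (lookup rows a) b ≡ ER a b
      ER′≡ER a b = trans (cong (λ row → lookup row b) (lookup∘tabulate _ a)) (lookup∘tabulate (ER a) b)
      ∈-treesOfSize : matrixTree m rows root ∈ treesOfSize m
      ∈-treesOfSize = ∈-concatMap⁺ (treesWithMatrix m)
        (Any.map (λ { refl → ∈-map⁺ (matrixTree m rows) (∈-allFin root) }) (∈-vectors (∈-vectors ∈-booleans) rows))
      ∈-treesUpTo : matrixTree m rows root ∈ treesUpTo s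
      ∈-treesUpTo = ∈-concatMap⁺ treesOfSize (Any.map (λ { refl → ∈-treesOfSize }) (∈-upTo⁺ (s≤s m≤s)))

module IndicatorSums where
  open import Data.Nat using (suc; _+_; _*_; _≤_; z≤n; s≤s)
  open import Data.Nat.Properties
    using (+-*-commutativeSemiring; +-mono-≤; ≤-reflexive; ≤-trans; +-suc; *-zeroʳ; *-identityʳ; module ≤-Reasoning)
  open import Data.List using (List; []; _∷_; length; filter)
  open import Data.List.Relation.Unary.All as All using (All)
  open import Data.List.Relation.Unary.All.Properties using (¬All⇒Any¬)
  open import Data.List.Relation.Unary.Any using (Any; here; there)
  open import Data.Empty using (⊥-elim)
  open import Relation.Nullary using (¬_; Dec; yes; no)
  open import Relation.Nullary.Decidable using (¬?)
  open import Relation.Unary using (Decidable)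
  open import Relation.Binary.PropositionalEquality using (_≡_; refl; sym; trans; cong)
  open ListSum +-*-commutativeSemiring public
  open Counting using (indicator; length-filter-∷)

  private variable
    A : Set

  ∑-mono : ∀ (xs : List A) {f g} → (∀ x → f x ≤ g x) → ∑ xs f ≤ ∑ xs g
  ∑-mono []       f≤g = z≤n
  ∑-mono (x ∷ xs) f≤g = +-mono-≤ (f≤g x) (∑-mono xs f≤g)

  ∑-const : ∀ (xs : List A) c → ∑ xs (λ _ → c) ≡ length xs * c
  ∑-const []       c = refl
  ∑-const (x ∷ xs) c = cong (c +_) (∑-const xs c)

  length-filter≡∑ : ∀ {P : A → Set} (P? : Decidable P) xs → length (filter P? xs) ≡ ∑ xs (λ x → indicator (P? x))
  length-filter≡∑ P? []       = refl
  length-filter≡∑ P? (x ∷ xs) = trans (length-filter-∷ P? x xs) (cong (indicator (P? x) +_) (length-filter≡∑ P? xs))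

  length-filter-¬ : ∀ {P : A → Set} (P? : Decidable P) xs →
                    length (filter P? xs) + length (filter (λ x → ¬? (P? x)) xs) ≡ length xs
  length-filter-¬ P? []       = refl
  length-filter-¬ P? (x ∷ xs) with P? x
  ... | yes _ = cong suc (length-filter-¬ P? xs)
  ... | no _  = trans (+-suc _ _) (cong suc (length-filter-¬ P? xs))

  markov : ∀ {B : A → Set} (B? : Decidable B) f t → (∀ x → B x → t ≤ f x) → ∀ xs →
           t * length (filter B? xs) ≤ ∑ xs f
  markov {B = B} B? f t t≤f xs = begin
    t * length (filter B? xs)              ≡⟨ cong (t *_) (length-filter≡∑ B? xs) ⟩
    t * ∑ xs (λ x → indicator (B? x))      ≡⟨ sym (∑-*ˡ xs t _) ⟩
    ∑ xs (λ x → t * indicator (B? x))      ≤⟨ ∑-mono xs (λ x → t*indicator≤ (B? x) (t≤f x)) ⟩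
    ∑ xs f                                 ∎
    where
    open ≤-Reasoning
    t*indicator≤ : ∀ {x} (b : Dec (B x)) → (B x → t ≤ f x) → t * indicator b ≤ f x
    t*indicator≤ (yes b) t≤fx = ≤-trans (≤-reflexive (*-identityʳ t)) (t≤fx b)
    t*indicator≤ (no _)  _    = ≤-trans (≤-reflexive (*-zeroʳ t)) z≤n

  union-bound : ∀ {I : Set} (is : List I) {Q : I → A → Set} (Q? : ∀ i → Decidable (Q i)) xs →
    length (filter (λ x → ¬? (All.all? (λ i → Q? i x) is)) xs) ≤ ∑ is (λ i → length (filter (λ x → ¬? (Q? i x)) xs))
  union-bound {I = I} is {Q} Q? xs = begin
    length (filter (λ x → ¬? (All.all? (λ i → Q? i x) is)) xs)
      ≡⟨ length-filter≡∑ _ xs ⟩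
    ∑ xs (λ x → indicator (¬? (All.all? (λ i → Q? i x) is)))
      ≤⟨ ∑-mono xs (λ x → some-fails x (All.all? (λ i → Q? i x) is)) ⟩
    ∑ xs (λ x → ∑ is (λ i → indicator (¬? (Q? i x))))
      ≡⟨ ∑-comm xs is _ ⟩
    ∑ is (λ i → ∑ xs (λ x → indicator (¬? (Q? i x))))
      ≡⟨ sym (∑-cong is (λ i → length-filter≡∑ _ xs)) ⟩
    ∑ is (λ i → length (filter (λ x → ¬? (Q? i x)) xs)) ∎
    where
    open ≤-Reasoning
    fails : ∀ {x} {js : List I} → Any (λ i → ¬ Q i x) js → 1 ≤ ∑ js (λ i → indicator (¬? (Q? i x)))
    fails {x} (here {i} ¬q) with Q? i x
    ... | yes q = ⊥-elim (¬q q)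
    ... | no _  = s≤s z≤n
    fails {x} (there {i} later) = ≤-trans (fails later) (Data.Nat.Properties.m≤n+m _ (indicator (¬? (Q? i x))))
    some-fails : ∀ x (all : Dec (All (λ i → Q i x) is)) → indicator (¬? all) ≤ ∑ is (λ i → indicator (¬? (Q? i x)))
    some-fails x (yes _)  = z≤n
    some-fails x (no ¬all) = fails (¬All⇒Any¬ (λ i → Q? i x) is ¬all)

module SecondMoment where
  open import Data.Nat as ℕ using (ℕ; zero; suc)
  open import Data.Integer using (ℤ; +_; 0ℤ; 1ℤ; _+_; _*_; _-_; -_)
  open import Data.Integer.Properties using (+-*-commutativeSemiring; *-zeroʳ; pos-+; pos-*)
  open import Data.Integer.Tactic.RingSolver using (solve-∀)
  open import Data.Fin using (Fin)
  open import Data.List using (List; []; _∷_; length; filter; allFin)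
  open import Data.List.Properties using (length-tabulate)
  open import Data.Vec using (Vec; _∷_; lookup)
  open import Relation.Nullary using (Dec; yes; no)
  open import Relation.Unary using (Decidable)
  open import Relation.Binary.PropositionalEquality using (_≡_; refl; sym; trans; cong; cong₂; module ≡-Reasoning)
  open ≡-Reasoning
  open ListSum +-*-commutativeSemiring public
  open Counting
  open RootedTreeShapes using (vectors; length-vectors)

  private variable
    A B : Set

  ∑-const : ∀ (xs : List A) c → ∑ xs (λ _ → c) ≡ c * + length xs
  ∑-const []       c = sym (*-zeroʳ c)
  ∑-const (x ∷ xs) c = trans (cong (_+_ c) (∑-const xs c)) (distrib c (+ length xs))
    where
    distrib : ∀ c n → c + c * n ≡ c * (1ℤ + n)
    distrib = solve-∀

  ∑-indicator : ∀ {P : A → Set} (P? : Decidable P) xs → ∑ xs (λ x → + indicator (P? x)) ≡ + length (filter P? xs)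
  ∑-indicator P? []       = refl
  ∑-indicator P? (x ∷ xs) = trans (cong (_+_ (+ indicator (P? x))) (∑-indicator P? xs))
                                  (trans (sym (pos-+ (indicator (P? x)) _)) (cong +_ (sym (length-filter-∷ P? x xs))))

  ∑∑-square : ∀ (xs : List A) (ys : List B) f g →
    ∑ xs (λ x → ∑ ys (λ y → (f y + g x) * (f y + g x)))
      ≡ + length xs * ∑ ys (λ y → f y * f y) + + 2 * ∑ xs g * ∑ ys f + + length ys * ∑ xs (λ x → g x * g x)
  ∑∑-square xs ys f g = begin
    ∑ xs (λ x → ∑ ys (λ y → (f y + g x) * (f y + g x)))
      ≡⟨ ∑-cong xs (λ x → ∑-cong ys (λ y → expand (f y) (g x))) ⟩
    ∑ xs (λ x → ∑ ys (λ y → f y * f y + (+ 2 * g x) * f y + g x * g x))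
      ≡⟨ ∑-cong xs (λ x → trans (∑-+ ys _ _) (cong₂ _+_ (∑-+ ys _ _) (∑-const ys (g x * g x)))) ⟩
    ∑ xs (λ x → ∑ ys (λ y → f y * f y) + ∑ ys (λ y → (+ 2 * g x) * f y) + g x * g x * + length ys)
      ≡⟨ trans (∑-+ xs _ _) (cong₂ _+_ (∑-+ xs _ _) refl) ⟩
    ∑ xs (λ _ → F²) + ∑ xs (λ x → ∑ ys (λ y → (+ 2 * g x) * f y)) + ∑ xs (λ x → g x * g x * + length ys)
      ≡⟨ cong₂ _+_ (cong₂ _+_ (∑-const xs F²) (trans (∑-cong xs (λ x → ∑-*ˡ ys (+ 2 * g x) f))
                                                     (∑-*ʳ xs (∑ ys f) (λ x → + 2 * g x))))
                   (∑-*ʳ xs (+ length ys) (λ x → g x * g x)) ⟩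
    F² * + length xs + ∑ xs (λ x → + 2 * g x) * ∑ ys f + ∑ xs (λ x → g x * g x) * + length ys
      ≡⟨ cong (λ t → F² * + length xs + t * ∑ ys f + ∑ xs (λ x → g x * g x) * + length ys) (∑-*ˡ xs (+ 2) g) ⟩
    F² * + length xs + + 2 * ∑ xs g * ∑ ys f + ∑ xs (λ x → g x * g x) * + length ys
      ≡⟨ rearrange F² (+ length xs) (∑ xs g) (∑ ys f) (∑ xs (λ x → g x * g x)) (+ length ys) ⟩
    + length xs * F² + + 2 * ∑ xs g * ∑ ys f + + length ys * ∑ xs (λ x → g x * g x) ∎
    where
    F² = ∑ ys (λ y → f y * f y)
    expand : ∀ a b → (a + b) * (a + b) ≡ a * a + (+ 2 * b) * a + b * b
    expand = solve-∀
    rearrange : ∀ F X G S H Y → F * X + + 2 * G * S + H * Y ≡ X * F + + 2 * G * S + Y * H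
    rearrange = solve-∀

  length-allFin : ∀ d → length (allFin d) ≡ d
  length-allFin d = length-tabulate (λ x → x)

  outcomes : (d Q : ℕ) → List (Vec (Fin d) Q)
  outcomes d = vectors (allFin d)

  length-outcomes : ∀ d Q → length (outcomes d Q) ≡ d ℕ.^ Q
  length-outcomes d Q = trans (length-vectors (allFin d) Q) (cong (ℕ._^ Q) (length-allFin d))

  module Variance (d : ℕ) {P : Fin d → Set} (P? : Decidable P) where
    m : ℕ
    m = count P?

    hits : ∀ {Q} → Vec (Fin d) Q → ℕ
    hits ω = count (λ j → P? (lookup ω j))

    deviation : ∀ Q → Vec (Fin d) Q → ℤ
    deviation Q ω = + d * + hits ω - + Q * + m

    centred : Fin d → ℤ
    centred x = + d * + indicator (P? x) - + m

    deviation-∷ : ∀ Q x ω → deviation (suc Q) (x ∷ ω) ≡ deviation Q ω + centred x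
    deviation-∷ Q x ω = begin
      + d * + hits (x ∷ ω) - + suc Q * + m
        ≡⟨ cong₂ (λ h q → + d * h - q * + m)
                 (trans (cong +_ (count-suc (λ j → P? (lookup (x ∷ ω) j)))) (pos-+ (indicator (P? x)) _)) (pos-+ 1 Q) ⟩
      + d * (+ indicator (P? x) + + hits ω) - (1ℤ + + Q) * + m
        ≡⟨ regroup (+ d) (+ indicator (P? x)) (+ hits ω) (+ Q) (+ m) ⟩
      deviation Q ω + centred x ∎
      where
      regroup : ∀ d i h q m → d * (i + h) - (1ℤ + q) * m ≡ (d * h - q * m) + (d * i - m)
      regroup = solve-∀

    ∑-affine : ∀ a b → ∑ (allFin d) (λ x → a * + indicator (P? x) + b) ≡ a * + m + b * + d
    ∑-affine a b = begin
      ∑ (allFin d) (λ x → a * + indicator (P? x) + b)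
        ≡⟨ ∑-+ (allFin d) (λ x → a * + indicator (P? x)) (λ _ → b) ⟩
      ∑ (allFin d) (λ x → a * + indicator (P? x)) + ∑ (allFin d) (λ _ → b)
        ≡⟨ cong₂ _+_ (trans (∑-*ˡ (allFin d) a _) (cong (a *_) (∑-indicator P? (allFin d))))
                     (trans (∑-const (allFin d) b) (cong (λ n → b * + n) (length-allFin d))) ⟩
      a * + m + b * + d ∎

    ∑-centred : ∑ (allFin d) centred ≡ 0ℤ
    ∑-centred = trans (∑-affine (+ d) (- + m)) (cancel (+ d) (+ m))
      where
      cancel : ∀ d m → d * m + - m * d ≡ 0ℤ
      cancel = solve-∀

    ∑-centred² : ∑ (allFin d) (λ x → centred x * centred x) ≡ + d * + m * (+ d - + m)
    ∑-centred² = begin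
      ∑ (allFin d) (λ x → centred x * centred x)
        ≡⟨ ∑-cong (allFin d) (λ x → square-affine (+ d) (+ m) (+ indicator (P? x)) (indicator² (P? x))) ⟩
      ∑ (allFin d) (λ x → (+ d * + d - + 2 * + d * + m) * + indicator (P? x) + + m * + m)
        ≡⟨ ∑-affine (+ d * + d - + 2 * + d * + m) (+ m * + m) ⟩
      (+ d * + d - + 2 * + d * + m) * + m + + m * + m * + d
        ≡⟨ collect (+ d) (+ m) ⟩
      + d * + m * (+ d - + m) ∎
      where
      indicator² : ∀ {A : Set} (a : Dec A) → + indicator a * + indicator a ≡ + indicator a
      indicator² (yes _) = refl
      indicator² (no _)  = refl
      square-affine : ∀ d m i → i * i ≡ i → (d * i - m) * (d * i - m) ≡ (d * d - + 2 * d * m) * i + m * m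
      square-affine d m i i²≡i =
        trans (expand d m i) (trans (cong (λ j → d * d * j - + 2 * d * m * i + m * m) i²≡i) (factor d m i))
        where
        expand : ∀ d m i → (d * i - m) * (d * i - m) ≡ d * d * (i * i) - + 2 * d * m * i + m * m
        expand = solve-∀
        factor : ∀ d m i → d * d * i - + 2 * d * m * i + m * m ≡ (d * d - + 2 * d * m) * i + m * m
        factor = solve-∀
      collect : ∀ d m → (d * d - + 2 * d * m) * m + m * m * d ≡ d * m * (d - m)
      collect = solve-∀

    private
      Ω = outcomes d

    ∑-deviation² : ∀ Q → ∑ (Ω Q) (λ ω → deviation Q ω * deviation Q ω) ≡ + Q * + m * (+ d - + m) * + (d ℕ.^ Q)
    ∑-deviation² zero    = simplify (+ d) (+ m)
      where
      simplify : ∀ d m → (d * 0ℤ - 0ℤ * m) * (d * 0ℤ - 0ℤ * m) + 0ℤ ≡ 0ℤ * m * (d - m) * 1ℤ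
      simplify = solve-∀
    ∑-deviation² (suc Q) = begin
      ∑ (Ω (suc Q)) (λ ω → deviation (suc Q) ω * deviation (suc Q) ω)
        ≡⟨ ∑-cartesianProductWith _∷_ (allFin d) (Ω Q) _ ⟩
      ∑ (allFin d) (λ x → ∑ (Ω Q) (λ ω → deviation (suc Q) (x ∷ ω) * deviation (suc Q) (x ∷ ω)))
        ≡⟨ ∑-cong (allFin d) (λ x → ∑-cong (Ω Q) (λ ω → cong (λ t → t * t) (deviation-∷ Q x ω))) ⟩
      ∑ (allFin d) (λ x → ∑ (Ω Q) (λ ω → (deviation Q ω + centred x) * (deviation Q ω + centred x)))
        ≡⟨ ∑∑-square (allFin d) (Ω Q) (deviation Q) centred ⟩
      + length (allFin d) * ∑ (Ω Q) (λ ω → deviation Q ω * deviation Q ω)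
        + + 2 * ∑ (allFin d) centred * ∑ (Ω Q) (deviation Q)
        + + length (Ω Q) * ∑ (allFin d) (λ x → centred x * centred x)
        ≡⟨ cong₂ _+_ (cong₂ _+_ (cong₂ _*_ (cong +_ (length-allFin d)) (∑-deviation² Q))
                                (cong (λ t → + 2 * t * ∑ (Ω Q) (deviation Q)) ∑-centred))
                     (cong₂ _*_ (cong +_ (length-outcomes d Q)) ∑-centred²) ⟩
      + d * (+ Q * + m * (+ d - + m) * + (d ℕ.^ Q)) + + 2 * 0ℤ * ∑ (Ω Q) (deviation Q)
        + + (d ℕ.^ Q) * (+ d * + m * (+ d - + m))
        ≡⟨ collect (+ d) (+ m) (+ Q) (+ (d ℕ.^ Q)) (∑ (Ω Q) (deviation Q)) ⟩
      (1ℤ + + Q) * + m * (+ d - + m) * (+ d * + (d ℕ.^ Q))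
        ≡⟨ cong₂ (λ q p → q * + m * (+ d - + m) * p) (sym (pos-+ 1 Q)) (sym (pos-* d (d ℕ.^ Q))) ⟩
      + suc Q * + m * (+ d - + m) * + (d ℕ.^ suc Q) ∎
      where
      collect : ∀ d m q D S → d * (q * m * (d - m) * D) + + 2 * 0ℤ * S + D * (d * m * (d - m))
                              ≡ (1ℤ + q) * m * (d - m) * (d * D)
      collect = solve-∀

module ChebyshevUnionBound where
  open import Data.Nat as ℕ using (ℕ; _+_; _*_; _^_; _∸_; _≤_; _≤?_; NonZero)
  open import Data.Nat.Properties
  import Data.Nat.Tactic.RingSolver as ℕ-Ring
  open import Data.Integer as ℤ using (ℤ; +_; ∣_∣)
  import Data.Integer.Properties as ℤₚ
  import Data.Integer.Tactic.RingSolver as ℤ-Ring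
  open import Data.Fin using (Fin)
  open import Data.List using (List; []; _∷_; length; filter)
  import Data.List.Relation.Unary.All as All
  open import Data.Vec using (Vec)
  open import Data.Sum using (inj₁; inj₂)
  open import Relation.Nullary using (¬_)
  open import Relation.Nullary.Decidable using (¬?)
  open import Relation.Unary using (Decidable)
  open import Relation.Binary.PropositionalEquality using (_≡_; refl; sym; trans; cong; cong₂; module ≡-Reasoning)
  open Counting using (count≤)
  open IndicatorSums using (∑; ∑-mono; ∑-*ˡ; ∑-const; markov; union-bound)
  module ℤΣ = SecondMoment

  pos-∑ : ∀ {A : Set} (xs : List A) f → + ∑ xs f ≡ ℤΣ.∑ xs (λ x → + f x)
  pos-∑ []       f = refl
  pos-∑ (x ∷ xs) f = trans (ℤₚ.pos-+ (f x) _) (cong (ℤ._+_ (+ f x)) (pos-∑ xs f))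

  ∣i∣²≡i² : ∀ i → + (∣ i ∣ * ∣ i ∣) ≡ i ℤ.* i
  ∣i∣²≡i² i with ℤₚ.+∣i∣≡i⊎+∣i∣≡-i i
  ... | inj₁ eq = trans (ℤₚ.pos-* ∣ i ∣ ∣ i ∣) (cong₂ ℤ._*_ eq eq)
  ... | inj₂ eq = trans (ℤₚ.pos-* ∣ i ∣ ∣ i ∣) (trans (cong₂ ℤ._*_ eq eq) (neg² i))
    where
    neg² : ∀ i → ℤ.- i ℤ.* ℤ.- i ≡ i ℤ.* i
    neg² = ℤ-Ring.solve-∀

  module _ (d Q : ℕ) {P : Fin d → Set} (P? : Decidable P) where
    open ℤΣ.Variance d P? using (m; deviation; ∑-deviation²)
    private
      Ω = ℤΣ.outcomes d

    ∑-∣deviation∣² : ∑ (Ω Q) (λ ω → ∣ deviation Q ω ∣ * ∣ deviation Q ω ∣) ≡ Q * m * (d ∸ m) * d ^ Q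
    ∑-∣deviation∣² = ℤₚ.+-injective (begin
      + ∑ (Ω Q) (λ ω → ∣ deviation Q ω ∣ * ∣ deviation Q ω ∣)
        ≡⟨ pos-∑ (Ω Q) _ ⟩
      ℤΣ.∑ (Ω Q) (λ ω → + (∣ deviation Q ω ∣ * ∣ deviation Q ω ∣))
        ≡⟨ ℤΣ.∑-cong (Ω Q) (λ ω → ∣i∣²≡i² (deviation Q ω)) ⟩
      ℤΣ.∑ (Ω Q) (λ ω → deviation Q ω ℤ.* deviation Q ω)
        ≡⟨ ∑-deviation² Q ⟩
      + Q ℤ.* + m ℤ.* (+ d ℤ.- + m) ℤ.* + (d ^ Q)
        ≡⟨ cong (λ k → + Q ℤ.* + m ℤ.* k ℤ.* + (d ^ Q)) d-m≡d∸m ⟩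
      + Q ℤ.* + m ℤ.* + (d ∸ m) ℤ.* + (d ^ Q)
        ≡⟨ sym (pos-*⁴ Q m (d ∸ m) (d ^ Q)) ⟩
      + (Q * m * (d ∸ m) * d ^ Q) ∎)
      where
      open ≡-Reasoning
      d-m≡d∸m : + d ℤ.- + m ≡ + (d ∸ m)
      d-m≡d∸m = trans (ℤₚ.[+m]-[+n]≡m⊖n d m) (ℤₚ.⊖-≥ (count≤ P?))
      pos-*⁴ : ∀ a b c e → + (a * b * c * e) ≡ + a ℤ.* + b ℤ.* + c ℤ.* + e
      pos-*⁴ a b c e = trans (ℤₚ.pos-* (a * b * c) e)
                      (cong (ℤ._* + e) (trans (ℤₚ.pos-* (a * b) c) (cong (ℤ._* + c) (ℤₚ.pos-* a b))))

  module Accuracy (d Q a b : ℕ) {I : Set} (is : List I) {P : I → Fin d → Set} (P? : ∀ i → Decidable (P i)) where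
    private
      module V (i : I) = ℤΣ.Variance d (P? i)
      Ω = ℤΣ.outcomes d

    -- With δ = a/b this says |m − (d/Q)·h(ω)| ≤ δd for the i-th predicate.
    Accurate : I → Vec (Fin d) Q → Set
    Accurate i ω = b * ∣ V.deviation i Q ω ∣ ≤ a * d * Q

    accurate? : ∀ i → Decidable (Accurate i)
    accurate? i ω = b * ∣ V.deviation i Q ω ∣ ≤? a * d * Q

    allAccurate? : Decidable (λ ω → All.All (λ i → Accurate i ω) is)
    allAccurate? ω = All.all? (λ i → accurate? i ω) is

    inaccurate : ℕ
    inaccurate = length (filter (λ ω → ¬? (allAccurate? ω)) (Ω Q))

    bound : ℕ
    bound = b * b * (Q * (d * d) * d ^ Q)

    chebyshev : ∀ i → (a * d * Q) * (a * d * Q) * length (filter (λ ω → ¬? (accurate? i ω)) (Ω Q)) ≤ bound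
    chebyshev i = begin
      (a * d * Q) * (a * d * Q) * length (filter (λ ω → ¬? (accurate? i ω)) (Ω Q))
        ≤⟨ markov (λ ω → ¬? (accurate? i ω)) (λ ω → b * b * (Y ω * Y ω)) _ far (Ω Q) ⟩
      ∑ (Ω Q) (λ ω → b * b * (Y ω * Y ω))
        ≡⟨ trans (∑-*ˡ (Ω Q) (b * b) _) (cong (b * b *_) (∑-∣deviation∣² d Q (P? i))) ⟩
      b * b * (Q * m * (d ∸ m) * d ^ Q)
        ≤⟨ *-monoʳ-≤ (b * b) (*-monoˡ-≤ (d ^ Q) (≤-trans (≤-reflexive (*-assoc Q m (d ∸ m)))
                                                  (*-monoʳ-≤ Q (*-mono-≤ (count≤ (P? i)) (m∸n≤m d m))))) ⟩
      bound ∎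
      where
      open ≤-Reasoning
      open V i using (m)
      Y : Vec (Fin d) Q → ℕ
      Y ω = ∣ V.deviation i Q ω ∣
      far : ∀ ω → ¬ Accurate i ω → (a * d * Q) * (a * d * Q) ≤ b * b * (Y ω * Y ω)
      far ω ¬acc = ≤-trans (*-mono-≤ adQ≤bY adQ≤bY) (≤-reflexive (interchange b (Y ω)))
        where
        adQ≤bY : a * d * Q ≤ b * Y ω
        adQ≤bY = <⇒≤ (≰⇒> ¬acc)
        interchange : ∀ b y → b * y * (b * y) ≡ b * b * (y * y)
        interchange = ℕ-Ring.solve-∀

    chebyshev-union : (a * d * Q) * (a * d * Q) * inaccurate ≤ length is * bound
    chebyshev-union = begin
      t * inaccurate                                                            ≤⟨ *-monoʳ-≤ t (union-bound is accurate? (Ω Q)) ⟩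
      t * ∑ is (λ i → length (filter (λ ω → ¬? (accurate? i ω)) (Ω Q)))          ≡⟨ sym (∑-*ˡ is t _) ⟩
      ∑ is (λ i → t * length (filter (λ ω → ¬? (accurate? i ω)) (Ω Q)))          ≤⟨ ∑-mono is chebyshev ⟩
      ∑ is (λ _ → bound)                                                        ≡⟨ ∑-const is bound ⟩
      length is * bound                                                         ∎
      where
      open ≤-Reasoning
      t = (a * d * Q) * (a * d * Q)

    inaccurate-fraction : ∀ N c e → length is ≤ N → 1 ≤ N → 1 ≤ b → 1 ≤ d → 1 ≤ Q →
      N * (b * b) * e ≤ a * a * c * Q → e * inaccurate ≤ c * d ^ Q
    inaccurate-fraction N c e is≤N 1≤N 1≤b 1≤d 1≤Q Nb²e≤a²cQ = *-cancelˡ-≤ M {{M≢0}} (begin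
      M * (e * T)                          ≡⟨ regroup₁ N b d Q e T ⟩
      N * (b * b) * e * (d * d * Q) * T    ≤⟨ *-monoˡ-≤ T (*-monoˡ-≤ (d * d * Q) Nb²e≤a²cQ) ⟩
      a * a * c * Q * (d * d * Q) * T      ≡⟨ regroup₂ a c Q d T ⟩
      c * ((a * d * Q) * (a * d * Q) * T)  ≤⟨ *-monoʳ-≤ c (≤-trans chebyshev-union (*-monoˡ-≤ bound is≤N)) ⟩
      c * (N * bound)                      ≡⟨ regroup₃ c N b Q d (d ^ Q) ⟩
      M * (c * d ^ Q)                      ∎)
      where
      open ≤-Reasoning
      T = inaccurate
      M = N * (b * b) * (d * d * Q)
      M≢0 : NonZero M
      M≢0 = ℕ.>-nonZero (*-mono-≤ (*-mono-≤ 1≤N (*-mono-≤ 1≤b 1≤b)) (*-mono-≤ (*-mono-≤ 1≤d 1≤d) 1≤Q))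
      regroup₁ : ∀ N b d Q e T → N * (b * b) * (d * d * Q) * (e * T) ≡ N * (b * b) * e * (d * d * Q) * T
      regroup₁ = ℕ-Ring.solve-∀
      regroup₂ : ∀ a c Q d T → a * a * c * Q * (d * d * Q) * T ≡ c * ((a * d * Q) * (a * d * Q) * T)
      regroup₂ = ℕ-Ring.solve-∀
      regroup₃ : ∀ c N b Q d D → c * (N * (b * b * (Q * (d * d) * D))) ≡ N * (b * b) * (d * d * Q) * (c * D)
      regroup₃ = ℕ-Ring.solve-∀

module RationalBounds where
  open import Data.Nat as ℕ using (ℕ; zero; suc; _+_; _*_; _^_; _≤_)
  import Data.Nat.Properties as ℕₚ
  open import Data.Integer as ℤ using (ℤ; +_; -[1+_]; ∣_∣)
  import Data.Integer.Properties as ℤₚ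
  import Data.Integer.Tactic.RingSolver as ℤ-Ring
  open import Data.Rational as ℚ using (ℚ; mkℚ; 0ℚ; 1ℚ; toℚᵘ; ↥_; ↧ₙ_; *<*) renaming (_/_ to _/ℚ_)
  import Data.Rational.Properties as ℚₚ
  open import Data.Rational.Unnormalised as ℚᵘ using (ℚᵘ; mkℚᵘ; *≤*; _≃_)
  import Data.Rational.Unnormalised.Properties as ℚᵘₚ
  open import Data.Sum using (inj₁; inj₂)
  open import Relation.Binary.PropositionalEquality using (_≡_; refl; sym; trans; cong; cong₂; subst; subst₂)

  toℚᵘ-ℕ→ℚ : ∀ n → toℚᵘ (ℕ→ℚ n) ≃ mkℚᵘ (+ n) 0
  toℚᵘ-ℕ→ℚ n = ℚₚ.toℚᵘ-fromℚᵘ (mkℚᵘ (+ n) 0)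

  toℚᵘ-/ : ∀ n q → toℚᵘ ((+ n) /ℚ suc q) ≃ mkℚᵘ (+ n) q
  toℚᵘ-/ n q = ℚₚ.toℚᵘ-fromℚᵘ (mkℚᵘ (+ n) q)

  toℚᵘ-reflects-≤ : ∀ {p q p′ q′} → toℚᵘ p ≃ p′ → toℚᵘ q ≃ q′ → p′ ℚᵘ.≤ q′ → p ℚ.≤ q
  toℚᵘ-reflects-≤ p≃ q≃ p′≤q′ =
    ℚₚ.toℚᵘ-cancel-≤ (ℚᵘₚ.≤-respˡ-≃ (ℚᵘₚ.≃-sym p≃) (ℚᵘₚ.≤-respʳ-≃ (ℚᵘₚ.≃-sym q≃) p′≤q′))

  _^ᵘ_ : ℚᵘ → ℕ → ℚᵘ
  p ^ᵘ zero  = ℚᵘ.1ℚᵘ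
  p ^ᵘ suc k = p ℚᵘ.* (p ^ᵘ k)

  toℚᵘ-^ : ∀ p k → toℚᵘ (p ^ℚ k) ≃ toℚᵘ p ^ᵘ k
  toℚᵘ-^ p zero    = ℚᵘₚ.≃-refl
  toℚᵘ-^ p (suc k) = ℚᵘₚ.≃-trans (ℚₚ.toℚᵘ-homo-* p (p ^ℚ k)) (ℚᵘₚ.*-congˡ {toℚᵘ p} (toℚᵘ-^ p k))

  ^ᵘ-cong : ∀ {p q} k → p ≃ q → p ^ᵘ k ≃ q ^ᵘ k
  ^ᵘ-cong zero    p≃q = ℚᵘₚ.≃-refl
  ^ᵘ-cong (suc k) p≃q = ℚᵘₚ.*-cong p≃q (^ᵘ-cong k p≃q)

  positive⇒1≤numerator : ∀ δ → 0ℚ ℚ.< δ → 1 ≤ ∣ ↥ δ ∣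
  positive⇒1≤numerator (mkℚ (+ a) b-1 _) (*<* 0<a) =
    ℤₚ.drop‿+<+ (subst₂ ℤ._<_ (ℤₚ.*-zeroˡ (+ suc b-1)) (ℤₚ.*-identityʳ (+ a)) 0<a)
  positive⇒1≤numerator (mkℚ -[1+ _ ] _ _) (*<* ())

  <1⇒numerator≤denominator : ∀ δ → 0ℚ ℚ.< δ → δ ℚ.< 1ℚ → ∣ ↥ δ ∣ ≤ ↧ₙ δ
  <1⇒numerator≤denominator (mkℚ (+ a) b-1 _) _ (*<* a<b) =
    ℕₚ.<⇒≤ (ℤₚ.drop‿+<+ (subst₂ ℤ._<_ (ℤₚ.*-identityʳ (+ a)) (ℤₚ.*-identityˡ (+ suc b-1)) a<b))
  <1⇒numerator≤denominator (mkℚ -[1+ _ ] _ _) (*<* ()) _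

  ∣m-n/q∣≤δd : ∀ δ → 0ℚ ℚ.< δ → ∀ d m₁ m₂ q →
    ↧ₙ δ * ∣ + d ℤ.* + m₂ ℤ.- + suc q ℤ.* + m₁ ∣ ≤ ∣ ↥ δ ∣ * d * suc q →
    ℚ.∣ ℕ→ℚ m₁ ℚ.- (+ (d * m₂)) /ℚ suc q ∣ ℚ.≤ δ ℚ.* ℕ→ℚ d
  ∣m-n/q∣≤δd δ@(mkℚ (+ a) b-1 _) _ d m₁ m₂ q b∣Y∣≤adq = toℚᵘ-reflects-≤ lhs≃ rhs≃ (*≤* cross)
    where
    x = ℕ→ℚ m₁
    y = (+ (d * m₂)) /ℚ suc q
    lhs≃ : toℚᵘ (ℚ.∣ x ℚ.- y ∣) ≃ ℚᵘ.∣ mkℚᵘ (+ m₁) 0 ℚᵘ.- mkℚᵘ (+ (d * m₂)) q ∣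
    lhs≃ = ℚᵘₚ.≃-trans (ℚₚ.toℚᵘ-homo-∣-∣ (x ℚ.- y))
             (ℚᵘₚ.∣-∣-cong (ℚᵘₚ.≃-trans (ℚₚ.toℚᵘ-homo-+ x (ℚ.- y))
               (ℚᵘₚ.+-cong (toℚᵘ-ℕ→ℚ m₁) (ℚᵘₚ.≃-trans (ℚₚ.toℚᵘ-homo‿- y) (ℚᵘₚ.-‿cong (toℚᵘ-/ (d * m₂) q))))))
    rhs≃ : toℚᵘ (δ ℚ.* ℕ→ℚ d) ≃ mkℚᵘ (+ a) b-1 ℚᵘ.* mkℚᵘ (+ d) 0
    rhs≃ = ℚᵘₚ.≃-trans (ℚₚ.toℚᵘ-homo-* δ (ℕ→ℚ d)) (ℚᵘₚ.*-congˡ {toℚᵘ δ} (toℚᵘ-ℕ→ℚ d))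
    Y = ∣ + d ℤ.* + m₂ ℤ.- + suc q ℤ.* + m₁ ∣
    numerator≡ : ∣ + m₁ ℤ.* + suc q ℤ.+ ℤ.- (+ (d * m₂)) ℤ.* + 1 ∣ ≡ Y
    numerator≡ = trans (cong ∣_∣ (trans (cong (λ k → + m₁ ℤ.* + suc q ℤ.+ ℤ.- k ℤ.* + 1) (ℤₚ.pos-* d m₂))
                                        (negate (+ m₁) (+ suc q) (+ d) (+ m₂))))
                       (ℤₚ.∣-i∣≡∣i∣ (+ d ℤ.* + m₂ ℤ.- + suc q ℤ.* + m₁))
      where
      negate : ∀ m₁ q d m₂ → m₁ ℤ.* q ℤ.+ ℤ.- (d ℤ.* m₂) ℤ.* ℤ.1ℤ ≡ ℤ.- (d ℤ.* m₂ ℤ.- q ℤ.* m₁)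
      negate = ℤ-Ring.solve-∀
    cross : + ∣ + m₁ ℤ.* + suc q ℤ.+ ℤ.- (+ (d * m₂)) ℤ.* + 1 ∣ ℤ.* + (suc b-1 * 1)
            ℤ.≤ (+ a ℤ.* + d) ℤ.* + (1 * suc q)
    cross = subst₂ ℤ._≤_
      (trans (ℤₚ.pos-* Y (suc b-1 * 1)) (cong (λ k → + k ℤ.* + (suc b-1 * 1)) (sym numerator≡)))
      (trans (ℤₚ.pos-* (a * d) (1 * suc q)) (cong (ℤ._* + (1 * suc q)) (ℤₚ.pos-* a d)))
      (ℤ.+≤+ (subst₂ _≤_ (trans (ℕₚ.*-comm (suc b-1) Y) (cong (Y *_) (sym (ℕₚ.*-identityʳ (suc b-1)))))
                         (cong (a * d *_) (sym (ℕₚ.*-identityˡ (suc q)))) b∣Y∣≤adq))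
  ∣m-n/q∣≤δd (mkℚ -[1+ _ ] _ _) (*<* ()) _ _ _ _ _

  m≤n+o⇒+m-+n≤+o : ∀ m n o → m ≤ n + o → + m ℤ.- + n ℤ.≤ + o
  m≤n+o⇒+m-+n≤+o m n o m≤n+o with ℕₚ.≤-total n m
  ... | inj₁ n≤m = subst (ℤ._≤ + o) (sym (trans (ℤₚ.[+m]-[+n]≡m⊖n m n) (ℤₚ.⊖-≥ n≤m)))
                         (ℤ.+≤+ (ℕₚ.m≤n+o⇒m∸n≤o m n m≤n+o))
  ... | inj₂ m≤n = subst (ℤ._≤ + o) (sym (trans (ℤₚ.[+m]-[+n]≡m⊖n m n) (ℤₚ.⊖-≤ m≤n))) ℤₚ.neg-≤-pos

  [1-τ]D≤G : ∀ τ → 0ℚ ℚ.< τ → ∀ D G T → ↧ₙ τ * T ≤ ∣ ↥ τ ∣ * D → G + T ≡ D →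
    (1ℚ ℚ.- τ) ℚ.* ℕ→ℚ D ℚ.≤ ℕ→ℚ G
  [1-τ]D≤G τ@(mkℚ (+ c) e-1 _) _ D G T eT≤cD G+T≡D = toℚᵘ-reflects-≤ lhs≃ (toℚᵘ-ℕ→ℚ G) (*≤* cross)
    where
    e = suc e-1
    lhs≃ : toℚᵘ ((1ℚ ℚ.- τ) ℚ.* ℕ→ℚ D) ≃ (ℚᵘ.1ℚᵘ ℚᵘ.- mkℚᵘ (+ c) e-1) ℚᵘ.* mkℚᵘ (+ D) 0
    lhs≃ = ℚᵘₚ.≃-trans (ℚₚ.toℚᵘ-homo-* (1ℚ ℚ.- τ) (ℕ→ℚ D))
             (ℚᵘₚ.*-cong (ℚᵘₚ.≃-trans (ℚₚ.toℚᵘ-homo-+ 1ℚ (ℚ.- τ)) (ℚᵘₚ.+-congʳ ℚᵘ.1ℚᵘ (ℚₚ.toℚᵘ-homo‿- τ)))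
                         (toℚᵘ-ℕ→ℚ D))
    eD≤cD+eG : e * D ≤ c * D + e * G
    eD≤cD+eG = begin
      e * D          ≡⟨ cong (e *_) (sym G+T≡D) ⟩
      e * (G + T)    ≡⟨ ℕₚ.*-distribˡ-+ e G T ⟩
      e * G + e * T  ≤⟨ ℕₚ.+-monoʳ-≤ (e * G) eT≤cD ⟩
      e * G + c * D  ≡⟨ ℕₚ.+-comm (e * G) (c * D) ⟩
      c * D + e * G  ∎
      where open ℕₚ.≤-Reasoning
    numerator≡ : (+ 1 ℤ.* + e ℤ.+ ℤ.- (+ c) ℤ.* + 1) ℤ.* + D ℤ.* + 1 ≡ + (e * D) ℤ.- + (c * D)
    numerator≡ = trans (expand (+ e) (+ c) (+ D)) (sym (cong₂ ℤ._-_ (ℤₚ.pos-* e D) (ℤₚ.pos-* c D)))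
      where
      expand : ∀ e c D → (ℤ.1ℤ ℤ.* e ℤ.+ ℤ.- c ℤ.* ℤ.1ℤ) ℤ.* D ℤ.* ℤ.1ℤ ≡ e ℤ.* D ℤ.- c ℤ.* D
      expand = ℤ-Ring.solve-∀
    cross : (+ 1 ℤ.* + e ℤ.+ ℤ.- (+ c) ℤ.* + 1) ℤ.* + D ℤ.* + 1 ℤ.≤ + G ℤ.* + (1 * e * 1)
    cross = subst₂ ℤ._≤_ (sym numerator≡)
      (trans (cong +_ (trans (ℕₚ.*-comm e G) (cong (G *_) (sym (trans (ℕₚ.*-identityʳ (1 * e)) (ℕₚ.*-identityˡ e))))))
             (ℤₚ.pos-* G (1 * e * 1)))
      (m≤n+o⇒+m-+n≤+o (e * D) (c * D) (e * G) eD≤cD+eG)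
  [1-τ]D≤G (mkℚ -[1+ _ ] _ _) (*<* ()) _ _ _ _ _

  pos-^ : ∀ n k → + (n ^ k) ≡ (+ n) ℤ.^ k
  pos-^ n zero    = refl
  pos-^ n (suc k) = trans (ℤₚ.pos-* n (n ^ k)) (cong (ℤ._*_ (+ n)) (pos-^ n k))

  ↥-^ᵘ : ∀ p k → ℚᵘ.↥ (p ^ᵘ k) ≡ ℚᵘ.↥ p ℤ.^ k
  ↥-^ᵘ p zero    = refl
  ↥-^ᵘ p (suc k) = trans (↥-* p (p ^ᵘ k)) (cong (ℤ._*_ (ℚᵘ.↥ p)) (↥-^ᵘ p k))
    where
    ↥-* : ∀ p q → ℚᵘ.↥ (p ℚᵘ.* q) ≡ ℚᵘ.↥ p ℤ.* ℚᵘ.↥ q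
    ↥-* (mkℚᵘ _ _) (mkℚᵘ _ _) = refl

  ↧-^ᵘ : ∀ p k → ℚᵘ.↧ₙ (p ^ᵘ k) ≡ ℚᵘ.↧ₙ p ^ k
  ↧-^ᵘ p zero    = refl
  ↧-^ᵘ p (suc k) = trans (↧-* p (p ^ᵘ k)) (cong (ℚᵘ.↧ₙ p *_) (↧-^ᵘ p k))
    where
    ↧-* : ∀ p q → ℚᵘ.↧ₙ (p ℚᵘ.* q) ≡ ℚᵘ.↧ₙ p * ℚᵘ.↧ₙ q
    ↧-* (mkℚᵘ _ _) (mkℚᵘ _ _) = refl

  [1+q][δτ]^k≤C : ∀ δ τ → 0ℚ ℚ.< δ → 0ℚ ℚ.< τ → ∀ q k C →
    suc q * (∣ ↥ δ ∣ * ∣ ↥ τ ∣) ^ k ≤ C * (↧ₙ δ * ↧ₙ τ) ^ k →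
    ℕ→ℚ (suc q) ℚ.* ((δ ℚ.* τ) ^ℚ k) ℚ.≤ ℕ→ℚ C
  [1+q][δτ]^k≤C δ@(mkℚ (+ a) b-1 _) τ@(mkℚ (+ c) e-1 _) _ _ q k C h =
    toℚᵘ-reflects-≤ lhs≃ (toℚᵘ-ℕ→ℚ C) bound
    where
    δτ = mkℚᵘ (+ a) b-1 ℚᵘ.* mkℚᵘ (+ c) e-1
    lhs≃ : toℚᵘ (ℕ→ℚ (suc q) ℚ.* ((δ ℚ.* τ) ^ℚ k)) ≃ mkℚᵘ (+ suc q) 0 ℚᵘ.* δτ ^ᵘ k
    lhs≃ = ℚᵘₚ.≃-trans (ℚₚ.toℚᵘ-homo-* (ℕ→ℚ (suc q)) ((δ ℚ.* τ) ^ℚ k))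
             (ℚᵘₚ.*-cong (toℚᵘ-ℕ→ℚ (suc q))
                         (ℚᵘₚ.≃-trans (toℚᵘ-^ (δ ℚ.* τ) k) (^ᵘ-cong k (ℚₚ.toℚᵘ-homo-* δ τ))))
    bound : mkℚᵘ (+ suc q) 0 ℚᵘ.* δτ ^ᵘ k ℚᵘ.≤ mkℚᵘ (+ C) 0
    bound with δτ ^ᵘ k | ↥-^ᵘ δτ k | ↧-^ᵘ δτ k
    ... | mkℚᵘ _ d-1 | refl | ↧≡ = *≤* (begin
      + suc q ℤ.* (+ a ℤ.* + c) ℤ.^ k ℤ.* + 1  ≡⟨ ℤₚ.*-identityʳ _ ⟩
      + suc q ℤ.* (+ a ℤ.* + c) ℤ.^ k         ≡⟨ cong (λ n → + suc q ℤ.* n ℤ.^ k) (sym (ℤₚ.pos-* a c)) ⟩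
      + suc q ℤ.* (+ (a * c)) ℤ.^ k           ≡⟨ cong (ℤ._*_ (+ suc q)) (sym (pos-^ (a * c) k)) ⟩
      + suc q ℤ.* + ((a * c) ^ k)             ≡⟨ sym (ℤₚ.pos-* (suc q) _) ⟩
      + (suc q * (a * c) ^ k)                 ≤⟨ ℤ.+≤+ h ⟩
      + (C * (suc b-1 * suc e-1) ^ k)         ≡⟨ ℤₚ.pos-* C _ ⟩
      + C ℤ.* + (suc b-1 * suc e-1) ^ k       ≡⟨ cong (λ n → + C ℤ.* + n) (trans (sym ↧≡) (sym (ℕₚ.*-identityˡ _))) ⟩
      + C ℤ.* + (1 * suc d-1)                 ∎)
      where open ℤₚ.≤-Reasoning
  [1+q][δτ]^k≤C (mkℚ -[1+ _ ] _ _) _ (*<* ()) _ _ _ _ _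
  [1+q][δτ]^k≤C (mkℚ (+ _) _ _) (mkℚ -[1+ _ ] _ _) _ (*<* ()) _ _ _ _

module SampleSize where
  open import Data.Nat as ℕ using (ℕ; zero; suc; pred; _+_; _*_; _^_; _≤_; z≤n; s≤s)
  open import Data.Nat.Properties as ℕₚ using (+-mono-≤; *-mono-≤; module ≤-Reasoning)
  open import Data.Nat.DivMod using (_/_; _%_; m≡m%n+[m/n]*n; m%n<n; m/n*n≤m)
  import Data.Nat.Tactic.RingSolver as ℕ-Ring
  open import Data.Integer as ℤ using (+_; ∣_∣)
  open import Data.Rational as ℚ using (ℚ; 0ℚ; 1ℚ; ↥_; ↧ₙ_)
  open import Data.Fin using (zero)
  open import Data.List using (List; length; filter)
  open import Data.List.Membership.Propositional using (_∈_)
  open import Data.List.Membership.Propositional.Properties using (∈-filter⁻)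
  open import Data.List.Relation.Unary.Any using (here; there)
  import Data.List.Relation.Unary.All as All
  open import Data.List.Relation.Unary.Unique.Propositional.Properties using (filter⁺; allFin⁺)
  open import Data.Vec using (lookup)
  open import Data.Product using (_,_; proj₁; proj₂)
  open import Relation.Binary.PropositionalEquality using (_≡_; sym; trans; subst₂)
  open Counting using (count-CountIs; CountIs-unique; CountIs-resp-⇔)
  open RootedTreeShapes using (treesUpTo; vectors-unique; GoodEdge-representative)
  open SecondMoment using (outcomes; length-outcomes)
  open IndicatorSums using (length-filter-¬)
  open RationalBounds

  [X/Y]*Y≤X : ∀ X Y → 1 ≤ Y → (X / suc (pred Y)) * Y ≤ X
  [X/Y]*Y≤X X (suc Y) _ = m/n*n≤m X (suc Y)

  X≤Y*[1+X/Y] : ∀ X Y → 1 ≤ Y → X ≤ Y * suc (X / suc (pred Y))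
  X≤Y*[1+X/Y] X (suc Y) _ = ℕₚ.<⇒≤ (begin-strict
    X                                  ≡⟨ m≡m%n+[m/n]*n X (suc Y) ⟩
    X % suc Y + (X / suc Y) * suc Y    <⟨ ℕₚ.+-monoˡ-< _ (m%n<n X (suc Y)) ⟩
    suc Y + (X / suc Y) * suc Y        ≡⟨ regroup Y (X / suc Y) ⟩
    suc Y * suc (X / suc Y)            ∎)
    where
    open ≤-Reasoning
    regroup : ∀ y z → suc y + z * suc y ≡ suc y * suc z
    regroup = ℕ-Ring.solve-∀

  cube-bound : ∀ q a b c e N → a ≤ b → c ≤ e → q * (a * a * c) ≤ N * (b * b) * e →
               suc q * (a * c) ^ 3 ≤ suc N * (b * e) ^ 3
  cube-bound q a b c e N a≤b c≤e qa²c≤Nb²e = begin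
    suc q * (a * c) ^ 3                          ≡⟨ split q a c ⟩
    q * (a * a * c) * (a * c * c) + (a * c) ^ 3   ≤⟨ +-mono-≤ (*-mono-≤ qa²c≤Nb²e (*-mono-≤ (*-mono-≤ a≤b c≤e) c≤e))
                                                            (ℕₚ.^-monoˡ-≤ 3 (*-mono-≤ a≤b c≤e)) ⟩
    N * (b * b) * e * (b * e * e) + (b * e) ^ 3   ≡⟨ merge N b e ⟩
    suc N * (b * e) ^ 3                          ∎
    where
    open ≤-Reasoning
    split : ∀ q a c → suc q * (a * c * (a * c * (a * c * 1))) ≡ q * (a * a * c) * (a * c * c) + a * c * (a * c * (a * c * 1))
    split = ℕ-Ring.solve-∀
    merge : ∀ N b e → N * (b * b) * e * (b * e * e) + b * e * (b * e * (b * e * 1)) ≡ suc N * (b * e * (b * e * (b * e * 1)))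
    merge = ℕ-Ring.solve-∀

  shapeBound : ℕ → ℕ
  shapeBound s = suc (length (treesUpTo s))

  -- suc ∘ pred keeps the division total; for 0 < δ, τ the divisor is positive anyway.
  sampleSize : ℕ → ℚ → ℚ → ℕ
  sampleSize s δ τ = shapeBound s * (↧ₙ δ * ↧ₙ δ) * ↧ₙ τ / suc (pred (∣ ↥ δ ∣ * ∣ ↥ δ ∣ * ∣ ↥ τ ∣))

  IsSRootedRoot⇒1≤deg : ∀ G s r → Partition.IsSRootedRoot G s r → 1 ≤ deg G r
  IsSRootedRoot⇒1≤deg G s r ((f , _ , r~f) , _) = nonempty (proj₁ (r~f zero))
    where
    nonempty : ∀ {A : Set} {x : A} {xs : List A} → x ∈ xs → 1 ≤ length xs
    nonempty (here _)  = s≤s z≤n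
    nonempty (there _) = s≤s z≤n

  module _ (G : AdjGraph) (s : ℕ) (r : V G) {δ : ℚ} (0<δ : 0ℚ ℚ.< δ) (q : ℕ) where
    open ChebyshevUnionBound.Accuracy (deg G r) (suc q) ∣ ↥ δ ∣ (↧ₙ δ) (treesUpTo s) (Decidability.goodEdge? G s r)

    allAccurate⇒GoodOutcome : ∀ ω → All.All (λ R → Accurate R ω) (treesUpTo s) → GoodOutcome G s r (suc q) δ ω
    allAccurate⇒GoodOutcome ω accurate R _ _ m≤s m₁ m₂ freq sample =
      ∣m-n/q∣≤δd δ 0<δ d m₁ m₂ q
        (subst₂ (λ h n → ↧ₙ δ * ∣ + d ℤ.* + h ℤ.- + suc q ℤ.* + n ∣ ≤ ∣ ↥ δ ∣ * d * suc q)
                (sym m₂≡hits) (sym m₁≡count) (All.lookup accurate R′∈trees))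
      where
      d = deg G r
      representative = GoodEdge-representative G s r R m≤s
      R′ = proj₁ representative
      R′∈trees = proj₁ (proj₂ representative)
      R⇔R′ = proj₂ (proj₂ representative)
      m₁≡count = CountIs-unique (CountIs-resp-⇔ R⇔R′ freq) (count-CountIs (Decidability.goodEdge? G s r R′))
      m₂≡hits  = CountIs-unique (CountIs-resp-⇔ (λ j → R⇔R′ (lookup ω j)) sample)
                                (count-CountIs (λ j → Decidability.goodEdge? G s r R′ (lookup ω j)))

  module _ (s : ℕ) {δ τ : ℚ} (0<δ : 0ℚ ℚ.< δ) (δ<1 : δ ℚ.< 1ℚ) (0<τ : 0ℚ ℚ.< τ) (τ<1 : τ ℚ.< 1ℚ) where
    private
      a = ∣ ↥ δ ∣
      b = ↧ₙ δ
      c = ∣ ↥ τ ∣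
      e = ↧ₙ τ
      N = shapeBound s
      q = sampleSize s δ τ
      1≤a²c : 1 ≤ a * a * c
      1≤a²c = *-mono-≤ (*-mono-≤ (positive⇒1≤numerator δ 0<δ) (positive⇒1≤numerator δ 0<δ))
                       (positive⇒1≤numerator τ 0<τ)

    sampleSize-polynomial : ℕ→ℚ (suc q) ℚ.* ((δ ℚ.* τ) ^ℚ 3) ℚ.≤ ℕ→ℚ (suc N)
    sampleSize-polynomial = [1+q][δτ]^k≤C δ τ 0<δ 0<τ q 3 (suc N)
      (cube-bound q a b c e N (<1⇒numerator≤denominator δ 0<δ δ<1) (<1⇒numerator≤denominator τ 0<τ τ<1)
                  ([X/Y]*Y≤X (N * (b * b) * e) (a * a * c) 1≤a²c))

    sampleSize-succeeds : ∀ G → IsForest G → ∀ r → Partition.IsSRootedRoot G s r →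
      ProbAtLeast (deg G r) (suc q) (GoodOutcome G s r (suc q) δ) (1ℚ ℚ.- τ)
    sampleSize-succeeds G _ r rooted =
      good ,
      filter⁺ allAccurate? (vectors-unique (allFin⁺ d) (suc q)) ,
      (λ ω ω∈good → allAccurate⇒GoodOutcome G s r 0<δ q ω
                       (proj₂ (∈-filter⁻ allAccurate? {xs = outcomes d (suc q)} ω∈good))) ,
      [1-τ]D≤G τ 0<τ (d ^ suc q) (length good) inaccurate
        (inaccurate-fraction N c e (ℕₚ.n≤1+n _) (s≤s z≤n) (s≤s z≤n) (IsSRootedRoot⇒1≤deg G s r rooted) (s≤s z≤n)
                             (X≤Y*[1+X/Y] (N * (b * b) * e) (a * a * c) 1≤a²c))
        (trans (length-filter-¬ allAccurate? (outcomes d (suc q))) (length-outcomes d (suc q)))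
      where
      d = deg G r
      open ChebyshevUnionBound.Accuracy d (suc q) a b (treesUpTo s) (Decidability.goodEdge? G s r)
      good = filter allAccurate? (outcomes d (suc q))

open import Data.Nat using (ℕ; suc; _≤_)
open import Data.Product using (Σ; _×_; _,_)
open import Data.Rational using (ℚ; 0ℚ; 1ℚ; _*_; _-_; _<_) renaming (_≤_ to _≤ℚ_)
open SampleSize using (sampleSize; shapeBound; sampleSize-polynomial; sampleSize-succeeds)

lemma5 : ∀ (s : ℕ) → 1 ≤ s →
    Σ (ℚ → ℚ → ℕ) λ q → Σ ℕ λ c → Σ ℕ λ k →
    ∀ (δ τ : ℚ) → 0ℚ < δ → δ < 1ℚ → 0ℚ < τ → τ < 1ℚ →
    (ℕ→ℚ (suc (q δ τ)) * ((δ * τ) ^ℚ k) ≤ℚ ℕ→ℚ c) ×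
    (∀ (G : AdjGraph) → IsForest G → ∀ (r : V G) → Partition.IsSRootedRoot G s r →
      ProbAtLeast (deg G r) (suc (q δ τ)) (GoodOutcome G s r (suc (q δ τ)) δ) (1ℚ - τ))
lemma5 s _ = sampleSize s , suc (shapeBound s) , 3 , λ δ τ 0<δ δ<1 0<τ τ<1 →
  sampleSize-polynomial s 0<δ δ<1 0<τ τ<1 , sampleSize-succeeds s 0<δ δ<1 0<τ τ<1
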